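{- Let $G$ be a singular simple graph whose set $CV$ of core vertices is independent, and let $\mathbf{Q}$ be the $|CV|\times|N(CV)|$ submatrix of the adjacency matrix of $G$ with rows indexed by $CV$ and columns indexed by $N(CV)$. Then the columns of $\mathbf{Q}$ are linearly independent if and only if $\eta(G)=|CV|-|N(CV)|$.
   Context: $\eta(G)=\dim\ker\mathbf{A}$ is the nullity of the $\{0,1\}$-adjacency matrix $\mathbf{A}$; $G$ is singular if $\eta(G)>0$. A vertex $v$ is a core vertex if some $\mathbf{x}\in\ker\mathbf{A}$ has $x_v\neq0$; $CV$ is the set of core vertices. $N(CV)$ is the set of vertices adjacent to at least one core vertex.
   Formalization: Kernel vectors of the adjacency matrix, and with them the nullity η(G), the core vertices and the linear independence of the columns of $\mathbf{Q}$, are taken over ℚ. -}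

module Defs where

open import Data.Bool using (Bool; true; false; if_then_else_)
open import Data.Nat using (ℕ; zero; suc; _<_)
open import Data.Fin using (Fin; zero; suc)
open import Data.Rational using (ℚ; 0ℚ; 1ℚ; _+_; _*_)
open import Data.List using (List; length; lookup)
open import Data.List.Membership.Propositional using (_∈_)
open import Data.List.Relation.Unary.Unique.Propositional using (Unique)
open import Data.Product using (Σ; ∃; _×_)
open import Function.Bundles using (_⇔_)
open import Relation.Binary.PropositionalEquality using (_≡_; _≢_)

record Graph (n : ℕ) : Set where
  field
    adj    : Fin n → Fin n → Bool
    sym    : ∀ i j → adj i j ≡ adj j i
    irrefl : ∀ i → adj i i ≡ false
open Graph public

sumFin : ∀ {k} → (Fin k → ℚ) → ℚ
sumFin {zero}  f = 0ℚ
sumFin {suc k} f = f zero + sumFin (λ i → f (suc i))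

A : ∀ {n} → Graph n → Fin n → Fin n → ℚ
A G i j = if adj G i j then 1ℚ else 0ℚ

InKer : ∀ {n} → Graph n → (Fin n → ℚ) → Set
InKer {n} G x = ∀ i → sumFin (λ j → A G i j * x j) ≡ 0ℚ

LinIndep : ∀ {m k} → (Fin k → Fin m → ℚ) → Set
LinIndep {m} {k} v =
  ∀ (c : Fin k → ℚ) → (∀ i → sumFin (λ b → c b * v b i) ≡ 0ℚ) → ∀ b → c b ≡ 0ℚ

Nullity : ∀ {n} → Graph n → ℕ → Set
Nullity {n} G k =
  Σ (Fin k → Fin n → ℚ) λ basis →
    (∀ b → InKer G (basis b)) × LinIndep basis ×
    (∀ x → InKer G x → ∃ λ (c : Fin k → ℚ) → ∀ i → x i ≡ sumFin (λ b → c b * basis b i))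

Singular : ∀ {n} → Graph n → Set
Singular G = ∃ λ k → Nullity G k × 0 < k

Core : ∀ {n} → Graph n → Fin n → Set
Core {n} G v = ∃ λ (x : Fin n → ℚ) → InKer G x × x v ≢ 0ℚ

CVIndependent : ∀ {n} → Graph n → Set
CVIndependent G = ∀ u v → Core G u → Core G v → adj G u v ≡ false

InNCV : ∀ {n} → Graph n → Fin n → Set
InNCV G v = ∃ λ u → Core G u × adj G u v ≡ true

Enumerates : ∀ {n} → (Fin n → Set) → List (Fin n) → Set
Enumerates P l = Unique l × (∀ v → (v ∈ l) ⇔ P v)

ColumnsIndependent : ∀ {n} → Graph n → (cv ncv : List (Fin n)) → Set
ColumnsIndependent G cv ncv =
  LinIndep {length cv} {length ncv} (λ j i → A G (lookup cv i) (lookup ncv j))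

-- Every kernel vector of A vanishes off CV, so restriction to CV identifies ker A with the
-- solutions y of Qᵀ y = 0: for w ∈ N(CV) the w-th equation of A x = 0 is the w-th equation of
-- Qᵀ y = 0, and every other equation is vacuous. Hence η(G) is the nullity of Qᵀ, and the
-- theorem is rank–nullity for Qᵀ. Over ℚ this follows from two facts: a homogeneous system with
-- more unknowns than equations has a nonzero solution (Gaussian elimination), and, the dot
-- product on ℚᵐ being positive definite, a vector in the kernel of some rows that lies in their
-- span or is orthogonal to the kernel is zero. So a kernel basis together with the rows has
-- only the trivial common solution (columns ≤ nullity + rows), and is independent when the
-- rows are (nullity + rows ≤ columns); under equality a dependent row could be dropped without
-- changing the kernel, contradicting the first inequality.

module Submission where

open import Data.Bool using (true; false; if_then_else_)
open import Data.Fin using (Fin; zero; suc; punchIn; punchOut; splitAt; _↑ˡ_; _↑ʳ_)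
open import Data.Fin.Properties
  using (punchInᵢ≢i; punchIn-punchOut; all?; ¬∀⟶∃¬; splitAt⁻¹-↑ˡ; splitAt⁻¹-↑ʳ)
  renaming (_≟_ to _≟ᶠ_)
open import Data.List using (List; []; _∷_; length; lookup)
open import Data.List.Membership.Propositional using (_∈_; _∉_)
open import Data.List.Membership.Propositional.Properties using (∈-lookup)
import Data.List.Membership.DecPropositional as DecMembership
import Data.List.Relation.Unary.All as All
open import Data.List.Relation.Unary.Any using (here; there; index)
open import Data.List.Relation.Unary.Any.Properties using (lookup-index)
open import Data.List.Relation.Unary.Unique.Propositional using (Unique; _∷_)
open import Data.Nat as ℕ using (ℕ; zero; suc; s≤s)
import Data.Nat.Properties as ℕₚ
open import Data.Product using (Σ; ∃; _×_; _,_; proj₁; proj₂)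
open import Data.Rational
  using (ℚ; 0ℚ; 1ℚ; _+_; _*_; -_; 1/_; _≤_; NonZero; ≢-nonZero; nonNegative; nonPositive)
open import Data.Rational.Properties
open import Algebra.Properties.Group +-0-group using (inverseˡ-unique; inverseʳ-unique)
open import Data.Rational.Solver using (module +-*-Solver)
open import Data.Sum using (inj₁; inj₂)
open import Data.Vec.Functional using (head; tail; insertAt; updateAt; _++_)
open import Data.Vec.Functional.Properties
  using (insertAt-lookup; insertAt-punchIn; updateAt-updates; updateAt-minimal;
         lookup-++ˡ; lookup-++ʳ)
open import Defs hiding (sym)
open import Function using (_∘_; const)
open import Function.Bundles using (_⇔_; mk⇔; Equivalence)
open import Relation.Binary.PropositionalEquality
  using (_≡_; _≢_; refl; sym; trans; cong; cong₂; subst; module ≡-Reasoning)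
open import Relation.Nullary using (yes; no; contradiction)

open +-*-Solver

*-cancel-zeroˡ : ∀ a b → a ≢ 0ℚ → a * b ≡ 0ℚ → b ≡ 0ℚ
*-cancel-zeroˡ a b a≢0 ab≡0 = begin
  b              ≡⟨ sym (*-identityˡ b) ⟩
  1ℚ * b         ≡⟨ cong (_* b) (sym (*-inverseˡ a)) ⟩
  (1/ a * a) * b ≡⟨ *-assoc (1/ a) a b ⟩
  1/ a * (a * b) ≡⟨ cong (1/ a *_) ab≡0 ⟩
  1/ a * 0ℚ      ≡⟨ *-zeroʳ (1/ a) ⟩
  0ℚ             ∎
  where
  open ≡-Reasoning
  instance
    a-nonZero : NonZero a
    a-nonZero = ≢-nonZero a≢0

square-zero : ∀ x → x * x ≡ 0ℚ → x ≡ 0ℚ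
square-zero x xx≡0 with x ≟ 0ℚ
... | yes x≡0 = x≡0
... | no  x≢0 = *-cancel-zeroˡ x x x≢0 xx≡0

square-nonneg : ∀ x → 0ℚ ≤ x * x
square-nonneg x with ≤-total 0ℚ x
... | inj₁ 0≤x = let instance _ = nonNegative 0≤x in
  nonNegative⁻¹ _ {{nonNeg*nonNeg⇒nonNeg x x}}
... | inj₂ x≤0 = let instance _ = nonPositive x≤0 in
  nonNegative⁻¹ _ {{nonPos*nonPos⇒nonPos x x}}

sumFin-cong : ∀ {k} {f g : Fin k → ℚ} → (∀ i → f i ≡ g i) → sumFin f ≡ sumFin g
sumFin-cong {zero}  f≗g = refl
sumFin-cong {suc k} f≗g = cong₂ _+_ (f≗g zero) (sumFin-cong (f≗g ∘ suc))

sumFin-zero : ∀ {k} {f : Fin k → ℚ} → (∀ i → f i ≡ 0ℚ) → sumFin f ≡ 0ℚ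
sumFin-zero {zero}  f≗0 = refl
sumFin-zero {suc k} f≗0 =
  trans (cong₂ _+_ (f≗0 zero) (sumFin-zero (f≗0 ∘ suc))) (+-identityˡ 0ℚ)

sumFin-+ : ∀ {k} (f g : Fin k → ℚ) → sumFin (λ i → f i + g i) ≡ sumFin f + sumFin g
sumFin-+ {zero}  f g = sym (+-identityˡ 0ℚ)
sumFin-+ {suc k} f g =
  trans (cong (f zero + g zero +_) (sumFin-+ (tail f) (tail g)))
        (solve 4 (λ a b c d → a :+ b :+ (c :+ d) := a :+ c :+ (b :+ d)) refl
               (f zero) (g zero) (sumFin (tail f)) (sumFin (tail g)))

sumFin-*ˡ : ∀ {k} a (f : Fin k → ℚ) → sumFin (λ i → a * f i) ≡ a * sumFin f
sumFin-*ˡ {zero}  a f = sym (*-zeroʳ a)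
sumFin-*ˡ {suc k} a f =
  trans (cong (a * f zero +_) (sumFin-*ˡ a (tail f))) (sym (*-distribˡ-+ a (f zero) _))

sumFin-neg : ∀ {k} (f : Fin k → ℚ) → sumFin (λ i → - f i) ≡ - sumFin f
sumFin-neg {zero}  f = refl
sumFin-neg {suc k} f =
  trans (cong (- f zero +_) (sumFin-neg (tail f))) (sym (neg-distrib-+ (f zero) _))

sumFin-swap : ∀ {k l} (f : Fin k → Fin l → ℚ) →
  sumFin (λ i → sumFin (f i)) ≡ sumFin (λ j → sumFin (λ i → f i j))
sumFin-swap {zero} {l} f = sym (sumFin-zero {l} (λ _ → refl))
sumFin-swap {suc k} f =
  trans (cong (sumFin (f zero) +_) (sumFin-swap (tail f))) (sym (sumFin-+ (f zero) _))

sumFin-punchIn : ∀ {k} (j : Fin (suc k)) (f : Fin (suc k) → ℚ) →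
  sumFin f ≡ f j + sumFin (f ∘ punchIn j)
sumFin-punchIn          zero    f = refl
sumFin-punchIn {suc k} (suc j) f =
  trans (cong (f zero +_) (sumFin-punchIn j (tail f)))
        (solve 3 (λ a b c → a :+ (b :+ c) := b :+ (a :+ c)) refl
               (f zero) (f (suc j)) (sumFin (tail f ∘ punchIn j)))

sumFin-↑ : ∀ {d k} (f : Fin (d ℕ.+ k) → ℚ) →
  sumFin f ≡ sumFin (λ i → f (i ↑ˡ k)) + sumFin (λ j → f (d ↑ʳ j))
sumFin-↑ {zero}  f = sym (+-identityˡ _)
sumFin-↑ {suc d} {k} f =
  trans (cong (f zero +_) (sumFin-↑ {d} {k} (tail f))) (sym (+-assoc (f zero) _ _))

sumFin-nonneg : ∀ {k} (f : Fin k → ℚ) → (∀ i → 0ℚ ≤ f i) → 0ℚ ≤ sumFin f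
sumFin-nonneg {zero}  f f≥0 = ≤-refl
sumFin-nonneg {suc k} f f≥0 =
  subst (_≤ sumFin f) (+-identityˡ 0ℚ)
        (+-mono-≤ (f≥0 zero) (sumFin-nonneg (tail f) (f≥0 ∘ suc)))

sumFin-nonneg-zero : ∀ {k} (f : Fin k → ℚ) → (∀ i → 0ℚ ≤ f i) →
  sumFin f ≡ 0ℚ → ∀ i → f i ≡ 0ℚ
sumFin-nonneg-zero {suc k} f f≥0 Σf≡0 = λ where
    zero    → f₀≡0
    (suc i) → sumFin-nonneg-zero (tail f) (f≥0 ∘ suc) rest≡0 i
  where
  rest≥0 : 0ℚ ≤ sumFin (tail f)
  rest≥0 = sumFin-nonneg (tail f) (f≥0 ∘ suc)
  f₀≤0 : f zero ≤ 0ℚ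
  f₀≤0 = subst (f zero ≤_) Σf≡0
    (subst (_≤ sumFin f) (+-identityʳ (f zero)) (+-monoʳ-≤ (f zero) rest≥0))
  f₀≡0 : f zero ≡ 0ℚ
  f₀≡0 = ≤-antisym f₀≤0 (f≥0 zero)
  rest≡0 : sumFin (tail f) ≡ 0ℚ
  rest≡0 = trans (sym (+-identityˡ _)) (trans (cong (_+ sumFin (tail f)) (sym f₀≡0)) Σf≡0)

infix 7 _·_

_·_ : ∀ {m} → (Fin m → ℚ) → (Fin m → ℚ) → ℚ
u · v = sumFin (λ i → u i * v i)

lincomb : ∀ {k m} → (Fin k → ℚ) → (Fin k → Fin m → ℚ) → Fin m → ℚ
lincomb c vs i = sumFin (λ b → c b * vs b i)

Annihilates : ∀ {k m} → (Fin k → Fin m → ℚ) → (Fin m → ℚ) → Set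
Annihilates r y = ∀ j → r j · y ≡ 0ℚ

·-comm : ∀ {m} (u v : Fin m → ℚ) → u · v ≡ v · u
·-comm u v = sumFin-cong (λ i → *-comm (u i) (v i))

self-·-zero : ∀ {m} (u : Fin m → ℚ) → u · u ≡ 0ℚ → ∀ i → u i ≡ 0ℚ
self-·-zero u u·u≡0 i =
  square-zero (u i) (sumFin-nonneg-zero _ (square-nonneg ∘ u) u·u≡0 i)

lincomb-· : ∀ {k m} (α : Fin k → ℚ) (vs : Fin k → Fin m → ℚ) (u : Fin m → ℚ) →
  lincomb α vs · u ≡ sumFin (λ l → α l * (vs l · u))
lincomb-· α vs u = begin
  sumFin (λ i → sumFin (λ l → α l * vs l i) * u i)
    ≡⟨ sumFin-cong (λ i → trans (*-comm (lincomb α vs i) (u i))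
                                (sym (sumFin-*ˡ (u i) (λ l → α l * vs l i)))) ⟩
  sumFin (λ i → sumFin (λ l → u i * (α l * vs l i)))
    ≡⟨ sumFin-swap (λ i l → u i * (α l * vs l i)) ⟩
  sumFin (λ l → sumFin (λ i → u i * (α l * vs l i)))
    ≡⟨ sumFin-cong (λ l → trans (sumFin-cong (λ i → reassoc (u i) (α l) (vs l i)))
                                (sumFin-*ˡ (α l) (λ i → vs l i * u i))) ⟩
  sumFin (λ l → α l * (vs l · u)) ∎
  where
  open ≡-Reasoning
  reassoc : ∀ x a y → x * (a * y) ≡ a * (y * x)
  reassoc = solve 3 (λ x a y → x :* (a :* y) := a :* (y :* x)) refl

lincomb-·-zero : ∀ {k m} (α : Fin k → ℚ) (vs : Fin k → Fin m → ℚ) (u : Fin m → ℚ) →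
  (∀ l → vs l · u ≡ 0ℚ) → lincomb α vs · u ≡ 0ℚ
lincomb-·-zero α vs u vs·u≡0 =
  trans (lincomb-· α vs u)
        (sumFin-zero (λ l → trans (cong (α l *_) (vs·u≡0 l)) (*-zeroʳ (α l))))

lincomb-annihilated : ∀ {k d m} {r : Fin k → Fin m → ℚ}
  (α : Fin d → ℚ) (vs : Fin d → Fin m → ℚ) →
  (∀ l → Annihilates r (vs l)) → Annihilates r (lincomb α vs)
lincomb-annihilated {r = r} α vs r·vs≡0 j =
  trans (·-comm (r j) (lincomb α vs))
        (lincomb-·-zero α vs (r j) (λ l → trans (·-comm (vs l) (r j)) (r·vs≡0 l j)))

lincomb-++ : ∀ {d k m} (c : Fin (d ℕ.+ k) → ℚ)
  (u : Fin d → Fin m → ℚ) (v : Fin k → Fin m → ℚ) i →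
  lincomb c (u ++ v) i ≡ lincomb (λ l → c (l ↑ˡ k)) u i + lincomb (λ j → c (d ↑ʳ j)) v i
lincomb-++ {d} {k} c u v i =
  trans (sumFin-↑ {d} {k} _)
        (cong₂ _+_ (sumFin-cong (λ l → cong (λ w → c (l ↑ˡ k) * w i) (lookup-++ˡ u v l)))
                   (sumFin-cong (λ j → cong (λ w → c (d ↑ʳ j) * w i) (lookup-++ʳ u v j))))

annihilates-++ : ∀ {d k m} {u : Fin d → Fin m → ℚ} {v : Fin k → Fin m → ℚ} {y} →
  Annihilates (u ++ v) y → Annihilates u y × Annihilates v y
annihilates-++ {d} {k} {u = u} {v} {y} uv·y≡0 =
  (λ l → subst (λ w → w · y ≡ 0ℚ) (lookup-++ˡ u v l) (uv·y≡0 (l ↑ˡ k))) ,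
  (λ j → subst (λ w → w · y ≡ 0ℚ) (lookup-++ʳ u v j) (uv·y≡0 (d ↑ʳ j)))

↑-elim : ∀ {d k} {P : Fin (d ℕ.+ k) → Set} →
  (∀ l → P (l ↑ˡ k)) → (∀ j → P (d ↑ʳ j)) → ∀ b → P b
↑-elim {d} {P = P} left right b with splitAt d b in eq
... | inj₁ l = subst P (splitAt⁻¹-↑ˡ eq) (left l)
... | inj₂ j = subst P (splitAt⁻¹-↑ʳ eq) (right j)

·-subtract-multiple : ∀ {m} (u v : Fin m → ℚ) c (z : Fin m → ℚ) →
  (λ i → u i + - (c * v i)) · z ≡ u · z + - (c * (v · z))
·-subtract-multiple u v c z = begin
  sumFin (λ i → (u i + - (c * v i)) * z i)
    ≡⟨ sumFin-cong (λ i → distrib (u i) (v i) c (z i)) ⟩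
  sumFin (λ i → u i * z i + - (c * (v i * z i)))
    ≡⟨ sumFin-+ (λ i → u i * z i) (λ i → - (c * (v i * z i))) ⟩
  u · z + sumFin (λ i → - (c * (v i * z i)))
    ≡⟨ cong (u · z +_) (trans (sumFin-neg (λ i → c * (v i * z i)))
                              (cong -_ (sumFin-*ˡ c (λ i → v i * z i)))) ⟩
  u · z + - (c * (v · z)) ∎
  where
  open ≡-Reasoning
  distrib : ∀ x y c w → (x + - (c * y)) * w ≡ x * w + - (c * (y * w))
  distrib = solve 4 (λ x y c w → (x :+ :- (c :* y)) :* w := x :* w :+ :- (c :* (y :* w))) refl

·-insertAt : ∀ {p} (R : Fin (suc p) → ℚ) (z : Fin p → ℚ) j t →
  R · insertAt z j t ≡ R j * t + (R ∘ punchIn j) · z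
·-insertAt R z j t =
  trans (sumFin-punchIn j (λ i → R i * insertAt z j t i))
        (cong₂ _+_ (cong (R j *_) (insertAt-lookup z j t))
                   (sumFin-cong (λ i → cong (R (punchIn j i) *_) (insertAt-punchIn z j t i))))

NontrivialSolution : ∀ {q p} → (Fin q → Fin p → ℚ) → Set
NontrivialSolution {p = p} M = Σ (Fin p → ℚ) λ y → Annihilates M y × ∃ λ i → y i ≢ 0ℚ

prepend-zero-row : ∀ {q p} {M : Fin (suc q) → Fin p → ℚ} → (∀ i → M zero i ≡ 0ℚ) →
  NontrivialSolution (tail M) → NontrivialSolution M
prepend-zero-row {M = M} row₀≡0 (y , tailM·y≡0 , nonzero) = y , M·y≡0 , nonzero
  where
  M·y≡0 : Annihilates M y
  M·y≡0 zero    = sumFin-zero (λ i → trans (cong (_* y i) (row₀≡0 i)) (*-zeroˡ (y i)))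
  M·y≡0 (suc l) = tailM·y≡0 l

module Elimination {q p} (M : Fin (suc q) → Fin (suc p) → ℚ) (j : Fin (suc p))
                   (pivot≢0 : M zero j ≢ 0ℚ) where

  private instance
    pivot-nonZero : NonZero (M zero j)
    pivot-nonZero = ≢-nonZero pivot≢0

  reduced : Fin q → Fin p → ℚ
  reduced l i = M (suc l) (punchIn j i) + - (M (suc l) j * 1/ M zero j * M zero (punchIn j i))

  back-substitute : NontrivialSolution reduced → NontrivialSolution M
  back-substitute (z , reduced·z≡0 , i , zᵢ≢0) =
    y , M·y≡0 , punchIn j i , λ yᵢ≡0 → zᵢ≢0 (trans (sym (insertAt-punchIn z j t i)) yᵢ≡0)
    where
    a S t : ℚ
    a = M zero j
    S = (M zero ∘ punchIn j) · z
    t = - (1/ a * S)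
    y : Fin (suc p) → ℚ
    y = insertAt z j t
    M·y≡0 : Annihilates M y
    M·y≡0 zero = begin
      M zero · y            ≡⟨ ·-insertAt (M zero) z j t ⟩
      a * t + S             ≡⟨ solve 3 (λ a b S → a :* (:- (b :* S)) :+ S := :- (a :* b :* S) :+ S)
                                     refl a (1/ a) S ⟩
      - (a * 1/ a * S) + S  ≡⟨ cong (λ w → - (w * S) + S) (*-inverseʳ a) ⟩
      - (1ℚ * S) + S        ≡⟨ cong (λ w → - w + S) (*-identityˡ S) ⟩
      - S + S               ≡⟨ +-inverseˡ S ⟩
      0ℚ                    ∎
      where open ≡-Reasoning
    M·y≡0 (suc l) = begin
      M (suc l) · y         ≡⟨ ·-insertAt (M (suc l)) z j t ⟩
      c * t + T             ≡⟨ solve 4 (λ c b S T → c :* (:- (b :* S)) :+ T := T :+ :- (c :* b :* S))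
                                     refl c (1/ a) S T ⟩
      T + - (c * 1/ a * S)  ≡⟨ sym (·-subtract-multiple (M (suc l) ∘ punchIn j) (M zero ∘ punchIn j)
                                                        (c * 1/ a) z) ⟩
      reduced l · z         ≡⟨ reduced·z≡0 l ⟩
      0ℚ                    ∎
      where
      open ≡-Reasoning
      c T : ℚ
      c = M (suc l) j
      T = (M (suc l) ∘ punchIn j) · z

homogeneous-nontrivial : ∀ {q p} → q ℕ.< p → (M : Fin q → Fin p → ℚ) → NontrivialSolution M
homogeneous-nontrivial {zero}  {suc p} _ M = const 1ℚ , (λ ()) , zero , λ ()
homogeneous-nontrivial {suc q} {suc p} (s≤s q<p) M with all? (λ i → M zero i ≟ 0ℚ)
... | yes row₀≡0 =
  prepend-zero-row {M = M} row₀≡0 (homogeneous-nontrivial (ℕₚ.m<n⇒m<1+n q<p) (tail M))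
... | no  row₀≢0 with ¬∀⟶∃¬ _ _ (λ i → M zero i ≟ 0ℚ) row₀≢0
...   | j , pivot≢0 = back-substitute (homogeneous-nontrivial q<p reduced)
  where open Elimination M j pivot≢0

solutions-trivial⇒≤ : ∀ {q p} (M : Fin q → Fin p → ℚ) →
  (∀ y → Annihilates M y → ∀ i → y i ≡ 0ℚ) → p ℕ.≤ q
solutions-trivial⇒≤ {q} {p} M trivial with p ℕ.≤? q
... | yes p≤q = p≤q
... | no  p≰q with homogeneous-nontrivial (ℕₚ.≰⇒> p≰q) M
...   | y , M·y≡0 , i , yᵢ≢0 = contradiction (trivial y M·y≡0 i) yᵢ≢0

LinIndep⇒≤ : ∀ {k m} (v : Fin k → Fin m → ℚ) → LinIndep v → k ℕ.≤ m
LinIndep⇒≤ v independent = solutions-trivial⇒≤ (λ i b → v b i) λ c vᵀ·c≡0 →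
  independent c (λ i → trans (sumFin-cong (λ b → *-comm (c b) (v b i))) (vᵀ·c≡0 i))

dependent-row-redundant : ∀ {k m} (r : Fin (suc k) → Fin m → ℚ) (β : Fin (suc k) → ℚ) b →
  (∀ i → lincomb β r i ≡ 0ℚ) → β b ≢ 0ℚ →
  ∀ y → Annihilates (r ∘ punchIn b) y → Annihilates r y
dependent-row-redundant r β b relation βb≢0 y others j with b ≟ᶠ j
... | no  b≢j = subst (λ l → r l · y ≡ 0ℚ) (punchIn-punchOut b≢j) (others (punchOut b≢j))
... | yes refl = *-cancel-zeroˡ (β b) (r b · y) βb≢0 (begin
  β b * (r b · y)
    ≡⟨ sym (+-identityʳ _) ⟩
  β b * (r b · y) + 0ℚ
    ≡⟨ cong (β b * (r b · y) +_) (sym (sumFin-zero λ l →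
         trans (cong (β (punchIn b l) *_) (others l)) (*-zeroʳ (β (punchIn b l))))) ⟩
  β b * (r b · y) + sumFin (λ l → β (punchIn b l) * (r (punchIn b l) · y))
    ≡⟨ sym (sumFin-punchIn b (λ l → β l * (r l · y))) ⟩
  sumFin (λ l → β l * (r l · y))
    ≡⟨ sym (lincomb-· β r y) ⟩
  lincomb β r · y
    ≡⟨ sumFin-zero (λ i → trans (cong (_* y i) (relation i)) (*-zeroˡ (y i))) ⟩
  0ℚ ∎)
  where open ≡-Reasoning

record KernelBasis {k m} (r : Fin k → Fin m → ℚ) (d : ℕ) : Set where
  field
    basis       : Fin d → Fin m → ℚ
    annihilated : ∀ b → Annihilates r (basis b)
    independent : LinIndep basis
    spanning    : ∀ y → Annihilates r y → Σ (Fin d → ℚ) λ c → ∀ i → y i ≡ lincomb c basis i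

KernelBasis-sameKernel : ∀ {k k′ m d} {r : Fin k → Fin m → ℚ} {r′ : Fin k′ → Fin m → ℚ} →
  (∀ y → Annihilates r y → Annihilates r′ y) → (∀ y → Annihilates r′ y → Annihilates r y) →
  KernelBasis r d → KernelBasis r′ d
KernelBasis-sameKernel ker⊆ker′ ker′⊆ker B = record
  { basis       = basis
  ; annihilated = λ b → ker⊆ker′ (basis b) (annihilated b)
  ; independent = independent
  ; spanning    = λ y r′·y≡0 → spanning y (ker′⊆ker y r′·y≡0)
  }
  where open KernelBasis B

module _ {k m d} {r : Fin k → Fin m → ℚ} (B : KernelBasis r d) where
  open KernelBasis B

  basis++rows-solutions-trivial : ∀ y → Annihilates (basis ++ r) y → ∀ i → y i ≡ 0ℚ
  basis++rows-solutions-trivial y basis++r·y≡0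
    with basis·y≡0 , r·y≡0 ← annihilates-++ {u = basis} {v = r} basis++r·y≡0
    with α , y≡αbasis ← spanning y r·y≡0 = self-·-zero y (begin
      y · y               ≡⟨ sumFin-cong (λ i → cong (_* y i) (y≡αbasis i)) ⟩
      lincomb α basis · y ≡⟨ lincomb-·-zero α basis y basis·y≡0 ⟩
      0ℚ                  ∎)
    where open ≡-Reasoning

  columns≤nullity+rows : m ℕ.≤ d ℕ.+ k
  columns≤nullity+rows = solutions-trivial⇒≤ (basis ++ r) basis++rows-solutions-trivial

  basis++rows-independent : LinIndep r → LinIndep (basis ++ r)
  basis++rows-independent r-independent c relation =
    ↑-elim {P = λ b → c b ≡ 0ℚ} (independent α u≡0) (r-independent β w≡0)
    where
    α : Fin d → ℚ
    α l = c (l ↑ˡ k)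
    β : Fin k → ℚ
    β j = c (d ↑ʳ j)
    u w : Fin m → ℚ
    u = lincomb α basis
    w = lincomb β r
    u+w≡0 : ∀ i → u i + w i ≡ 0ℚ
    u+w≡0 i = trans (sym (lincomb-++ c basis r i)) (relation i)
    u·u≡0 : u · u ≡ 0ℚ
    u·u≡0 = begin
      u · u
        ≡⟨ sumFin-cong (λ i → cong (_* u i) (inverseˡ-unique (u i) (w i) (u+w≡0 i))) ⟩
      (-_ ∘ w) · u
        ≡⟨ sumFin-cong (λ i → sym (neg-distribˡ-* (w i) (u i))) ⟩
      sumFin (λ i → - (w i * u i))
        ≡⟨ sumFin-neg (λ i → w i * u i) ⟩
      - (w · u)
        ≡⟨ cong -_ (lincomb-·-zero β r u u-annihilated) ⟩
      0ℚ ∎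
      where
      open ≡-Reasoning
      u-annihilated : Annihilates r u
      u-annihilated = lincomb-annihilated {r = r} α basis annihilated
    u≡0 : ∀ i → u i ≡ 0ℚ
    u≡0 = self-·-zero u u·u≡0
    w≡0 : ∀ i → w i ≡ 0ℚ
    w≡0 i = trans (inverseʳ-unique (u i) (w i) (u+w≡0 i)) (cong -_ (u≡0 i))

  nullity+rows≤columns : LinIndep r → d ℕ.+ k ℕ.≤ m
  nullity+rows≤columns r-independent = LinIndep⇒≤ (basis ++ r) (basis++rows-independent r-independent)

columns≡nullity+rows⇒independent : ∀ {k m d} {r : Fin k → Fin m → ℚ} →
  KernelBasis r d → m ≡ d ℕ.+ k → LinIndep r
columns≡nullity+rows⇒independent {suc k} {m} {d} {r} B m≡d+1+k β relation b with β b ≟ 0ℚ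
... | yes βb≡0 = βb≡0
... | no  βb≢0 =
  contradiction (columns≤nullity+rows B′) (ℕₚ.<⇒≱ (ℕₚ.≤-reflexive (sym m≡1+d+k)))
  where
  B′ : KernelBasis (r ∘ punchIn b) d
  B′ = KernelBasis-sameKernel (λ y r·y≡0 → r·y≡0 ∘ punchIn b)
                              (dependent-row-redundant r β b relation βb≢0) B
  m≡1+d+k : m ≡ suc (d ℕ.+ k)
  m≡1+d+k = trans m≡d+1+k (ℕₚ.+-suc d k)

sumFin-updateAt-zero : ∀ {n} (a : Fin n) (g : Fin n → ℚ) →
  sumFin g ≡ g a + sumFin (updateAt g a (const 0ℚ))
sumFin-updateAt-zero {suc n} a g = trans (sumFin-punchIn a g) (cong (g a +_) (sym (begin
  sumFin g₀                       ≡⟨ sumFin-punchIn a g₀ ⟩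
  g₀ a + sumFin (g₀ ∘ punchIn a)  ≡⟨ cong₂ _+_ (updateAt-updates a g) (sumFin-cong λ i →
                                       updateAt-minimal (punchIn a i) a g (punchInᵢ≢i a i)) ⟩
  0ℚ + sumFin (g ∘ punchIn a)     ≡⟨ +-identityˡ _ ⟩
  sumFin (g ∘ punchIn a)          ∎)))
  where
  open ≡-Reasoning
  g₀ : Fin (suc n) → ℚ
  g₀ = updateAt g a (const 0ℚ)

sumFin-over-support : ∀ {n} (l : List (Fin n)) → Unique l → (g : Fin n → ℚ) →
  (∀ v → v ∉ l → g v ≡ 0ℚ) → sumFin g ≡ sumFin (g ∘ lookup l)
sumFin-over-support []      _            g g≡0 = sumFin-zero (λ v → g≡0 v λ ())
sumFin-over-support {n} (a ∷ l) (a∉l ∷ uniq) g g≡0 =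
  trans (sumFin-updateAt-zero a g) (cong (g a +_) (begin
  sumFin g₀               ≡⟨ sumFin-over-support l uniq g₀ g₀≡0 ⟩
  sumFin (g₀ ∘ lookup l)  ≡⟨ sumFin-cong (λ i → updateAt-minimal (lookup l i) a g
                               (All.lookup a∉l (∈-lookup i) ∘ sym)) ⟩
  sumFin (g ∘ lookup l)   ∎))
  where
  open ≡-Reasoning
  g₀ : Fin n → ℚ
  g₀ = updateAt g a (const 0ℚ)
  g₀≡0 : ∀ v → v ∉ l → g₀ v ≡ 0ℚ
  g₀≡0 v v∉l with v ≟ᶠ a
  ... | yes refl = updateAt-updates a g
  ... | no  v≢a  = trans (updateAt-minimal v a g v≢a)
                         (g≡0 v λ { (here v≡a) → v≢a v≡a ; (there v∈l) → v∉l v∈l })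

extendByZero : ∀ {n} (l : List (Fin n)) → (Fin (length l) → ℚ) → Fin n → ℚ
extendByZero []      y = const 0ℚ
extendByZero (a ∷ l) y = updateAt (extendByZero l (tail y)) a (const (head y))

extendByZero-∉ : ∀ {n} (l : List (Fin n)) y {v} → v ∉ l → extendByZero l y v ≡ 0ℚ
extendByZero-∉ []      y v∉l = refl
extendByZero-∉ (a ∷ l) y v∉l =
  trans (updateAt-minimal _ a (extendByZero l (tail y)) (v∉l ∘ here))
        (extendByZero-∉ l (tail y) (v∉l ∘ there))

extendByZero-lookup : ∀ {n} (l : List (Fin n)) → Unique l → ∀ y i →
  extendByZero l y (lookup l i) ≡ y i
extendByZero-lookup (a ∷ l) _            y zero    = updateAt-updates a (extendByZero l (tail y))
extendByZero-lookup (a ∷ l) (a∉l ∷ uniq) y (suc i) =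
  trans (updateAt-minimal (lookup l i) a (extendByZero l (tail y))
                          (All.lookup a∉l (∈-lookup i) ∘ sym))
        (extendByZero-lookup l uniq (tail y) i)

A-sym : ∀ {n} (G : Graph n) u v → A G u v ≡ A G v u
A-sym G u v = cong (if_then 1ℚ else 0ℚ) (Graph.sym G u v)

module CoreRestriction {n} (G : Graph n) (cv ncv : List (Fin n))
                       (cv-enum : Enumerates (Core G) cv) (ncv-enum : Enumerates (InNCV G) ncv) where

  open DecMembership (_≟ᶠ_ {n}) using (_∈?_)

  -- Q j is the j-th column of the paper's Q, i.e. the j-th row of Qᵀ.
  Q : Fin (length ncv) → Fin (length cv) → ℚ
  Q j i = A G (lookup cv i) (lookup ncv j)

  zero-off-core : ∀ x → InKer G x → ∀ v → v ∉ cv → x v ≡ 0ℚ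
  zero-off-core x x∈ker v v∉cv with x v ≟ 0ℚ
  ... | yes xᵥ≡0 = xᵥ≡0
  ... | no  xᵥ≢0 = contradiction (Equivalence.from (proj₂ cv-enum v) (x , x∈ker , xᵥ≢0)) v∉cv

  zero-from-core : ∀ (x : Fin n → ℚ) → (∀ v → v ∉ cv → x v ≡ 0ℚ) →
    (∀ i → x (lookup cv i) ≡ 0ℚ) → ∀ v → x v ≡ 0ℚ
  zero-from-core x off-core on-core v with v ∈? cv
  ... | yes v∈cv = trans (cong x (lookup-index v∈cv)) (on-core (index v∈cv))
  ... | no  v∉cv = off-core v v∉cv

  A·-over-core : ∀ w (x : Fin n → ℚ) → (∀ v → v ∉ cv → x v ≡ 0ℚ) →
    A G w · x ≡ sumFin (λ i → A G w (lookup cv i) * x (lookup cv i))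
  A·-over-core w x off-core = sumFin-over-support cv (proj₁ cv-enum) _ λ v v∉cv →
    trans (cong (A G w v *_) (off-core v v∉cv)) (*-zeroʳ (A G w v))

  non-neighbour-of-core : ∀ w → w ∉ ncv → ∀ i → A G w (lookup cv i) ≡ 0ℚ
  non-neighbour-of-core w w∉ncv i with adj G w (lookup cv i) in wᵢ-adjacent
  ... | false = refl
  ... | true  = contradiction w∈ncv w∉ncv
    where
    cvᵢ-core : Core G (lookup cv i)
    cvᵢ-core = Equivalence.to (proj₂ cv-enum (lookup cv i)) (∈-lookup i)
    cvᵢ-adjacent : adj G (lookup cv i) w ≡ true
    cvᵢ-adjacent = trans (Graph.sym G (lookup cv i) w) wᵢ-adjacent
    w∈ncv : w ∈ ncv
    w∈ncv = Equivalence.from (proj₂ ncv-enum w) (lookup cv i , cvᵢ-core , cvᵢ-adjacent)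

  restrict-kernel : ∀ x → InKer G x → Annihilates Q (x ∘ lookup cv)
  restrict-kernel x x∈ker j = begin
    Q j · (x ∘ lookup cv)
      ≡⟨ sumFin-cong (λ i → cong (_* x (lookup cv i)) (A-sym G (lookup cv i) (lookup ncv j))) ⟩
    sumFin (λ i → A G (lookup ncv j) (lookup cv i) * x (lookup cv i))
      ≡⟨ sym (A·-over-core (lookup ncv j) x (zero-off-core x x∈ker)) ⟩
    A G (lookup ncv j) · x
      ≡⟨ x∈ker (lookup ncv j) ⟩
    0ℚ ∎
    where open ≡-Reasoning

  core-columns-annihilate : ∀ y → Annihilates Q y →
    ∀ w → sumFin (λ i → A G w (lookup cv i) * y i) ≡ 0ℚ
  core-columns-annihilate y Q·y≡0 w with w ∈? ncv
  ... | yes w∈ncv = begin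
    sumFin (λ i → A G w (lookup cv i) * y i)
      ≡⟨ sumFin-cong (λ i → cong (λ u → A G u (lookup cv i) * y i) (lookup-index w∈ncv)) ⟩
    sumFin (λ i → A G (lookup ncv j) (lookup cv i) * y i)
      ≡⟨ sumFin-cong (λ i → cong (_* y i) (A-sym G (lookup ncv j) (lookup cv i))) ⟩
    Q j · y
      ≡⟨ Q·y≡0 j ⟩
    0ℚ ∎
    where
    open ≡-Reasoning
    j : Fin (length ncv)
    j = index w∈ncv
  ... | no  w∉ncv = sumFin-zero λ i →
    trans (cong (_* y i) (non-neighbour-of-core w w∉ncv i)) (*-zeroˡ (y i))

  extend-kernel : ∀ y → Annihilates Q y → InKer G (extendByZero cv y)
  extend-kernel y Q·y≡0 w = begin
    A G w · x
      ≡⟨ A·-over-core w x (λ v → extendByZero-∉ cv y) ⟩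
    sumFin (λ i → A G w (lookup cv i) * x (lookup cv i))
      ≡⟨ sumFin-cong (λ i → cong (A G w (lookup cv i) *_)
                                 (extendByZero-lookup cv (proj₁ cv-enum) y i)) ⟩
    sumFin (λ i → A G w (lookup cv i) * y i)
      ≡⟨ core-columns-annihilate y Q·y≡0 w ⟩
    0ℚ ∎
    where
    open ≡-Reasoning
    x : Fin n → ℚ
    x = extendByZero cv y

  restrict-kernelBasis : ∀ {η} → Nullity G η → KernelBasis Q η
  restrict-kernelBasis {η} (B , B∈ker , B-independent , B-spanning) = record
    { basis       = λ b → B b ∘ lookup cv
    ; annihilated = λ b → restrict-kernel (B b) (B∈ker b)
    ; independent = λ c relation →
        B-independent c (zero-from-core (lincomb c B) (combination-off-core c) relation)
    ; spanning    = spanning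
    }
    where
    combination-off-core : ∀ c v → v ∉ cv → lincomb c B v ≡ 0ℚ
    combination-off-core c v v∉cv = sumFin-zero λ b →
      trans (cong (c b *_) (zero-off-core (B b) (B∈ker b) v v∉cv)) (*-zeroʳ (c b))
    spanning : ∀ y → Annihilates Q y →
      Σ (Fin η → ℚ) λ c → ∀ i → y i ≡ lincomb c (λ b → B b ∘ lookup cv) i
    spanning y Q·y≡0 with c , x≡cB ← B-spanning (extendByZero cv y) (extend-kernel y Q·y≡0) =
      c , λ i → trans (sym (extendByZero-lookup cv (proj₁ cv-enum) y i)) (x≡cB (lookup cv i))

-- Imported only here: ℤ's prefix +_ makes ℚ sections such as (a +_) ambiguous.
open import Data.Integer using (+_; _-_)
import Data.Integer as ℤ
import Data.Integer.Properties as ℤₚ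
open import Algebra.Properties.AbelianGroup ℤₚ.+-0-abelianGroup
  using (//-rightDividesˡ; //-rightDividesʳ)

+η≡c-k⇔c≡η+k : ∀ η c k → (+ η ≡ + c - + k) ⇔ (c ≡ η ℕ.+ k)
+η≡c-k⇔c≡η+k η c k = mk⇔ to from
  where
  to : + η ≡ + c - + k → c ≡ η ℕ.+ k
  to η≡c-k = ℤₚ.+-injective (begin
    + c                     ≡⟨ sym (//-rightDividesˡ (+ k) (+ c)) ⟩
    (+ c - + k) ℤ.+ + k     ≡⟨ cong (ℤ._+ + k) (sym η≡c-k) ⟩
    + η ℤ.+ + k             ≡⟨ sym (ℤₚ.pos-+ η k) ⟩
    + (η ℕ.+ k)             ∎)
    where open ≡-Reasoning
  from : c ≡ η ℕ.+ k → + η ≡ + c - + k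
  from refl = sym (trans (cong (_- + k) (ℤₚ.pos-+ η k)) (//-rightDividesʳ (+ k) (+ η)))

mainTheorem5 : ∀ {n} (G : Graph n) (cv ncv : List (Fin n)) →
    Enumerates (Core G) cv → Enumerates (InNCV G) ncv →
    Singular G → CVIndependent G →
    (η : ℕ) → Nullity G η →
    (ColumnsIndependent G cv ncv ⇔ (+ η ≡ + length cv - + length ncv))
mainTheorem5 G cv ncv cv-enum ncv-enum _ _ η nullity = mk⇔
  (λ Q-independent →
     from (ℕₚ.≤-antisym (columns≤nullity+rows B) (nullity+rows≤columns B Q-independent)))
  (λ η≡c-k → columns≡nullity+rows⇒independent B (to η≡c-k))
  where
  open CoreRestriction G cv ncv cv-enum ncv-enum
  open Equivalence (+η≡c-k⇔c≡η+k η (length cv) (length ncv))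
  B : KernelBasis Q η
  B = restrict-kernelBasis nullity
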